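{- Let $G$ be a finite simple graph on $n$ vertices. If $r\ge n$ and $B$ is an optimal AMON $r$-fold forcing set for $G$, then $a(B)+m(B)=Z^-(G)$.
   Context: Skew zero forcing: initially some set of vertices of $G$ is blue and the rest white; if $w$ is the only white neighbor of any vertex $u$ (blue or white), then $u$ may color $w$ blue. $Z^-(G)$ is the minimum cardinality of an initial blue set from which all vertices can be made blue. For $r\in\mathbb{N}$, the $r$-blowup $G^{(r)}$ is obtained by replacing each vertex $u$ by an independent set $R_u$ of $r$ vertices (a cluster) and each edge $uw$ by all edges between $R_u$ and $R_w$. $r$-fold forcing game: an initial set $B\subseteq V(G^{(r)})$ is blue, the rest white; at each step, with $B_t$ the current blue set, a vertex $u\in B_t$ with $|N(u)\setminus B_t|\le r$ colors all of $N(u)\setminus B_t$ blue. $B$ is an $r$-fold forcing set if repeated application can make all of $G^{(r)}$ blue; $Z_{(r)}(G)$ is the minimum cardinality of such a set. A cluster is forced at a step if some of its vertices turn from white to blue at that step. Relative to the coloring by $B$, a cluster is an All cluster (all vertices blue), a Most cluster (for $r\ge3$: exactly $r-1$ vertices blue), a One cluster (exactly one vertex blue), or a None cluster (all white). An AMON $r$-fold forcing set is an $r$-fold forcing set for which every cluster is All, Most, One, or None; $a(B)$, $m(B)$, $\ell(B)$ denote the numbers of All, Most, One clusters. An optimal AMON $r$-fold forcing set is an AMON $r$-fold forcing set of cardinality $Z_{(r)}(G)$ for which there is a forcing process in which at each step either exactly one cluster is forced, or exactly two clusters are forced simultaneously, one a One cluster and the other a Most cluster (two One clusters when $r=2$).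 -}

module Defs where

open import Data.Nat using (ℕ; zero; suc; _+_; _∸_; _≤_)
open import Data.Fin using (Fin; zero; suc; _≟_)
open import Data.Bool using (Bool; true; false; if_then_else_; _∨_; not)
open import Data.Product using (Σ; _×_; _,_)
open import Data.Sum using (_⊎_)
open import Data.List using (List; []; _∷_; filter; length)
open import Data.List.Base using (allFin)
open import Data.Unit using (⊤)
open import Relation.Nullary using (does; ¬_)
open import Relation.Nullary.Decidable using (T?)
open import Relation.Binary.PropositionalEquality using (_≡_)

record Graph (n : ℕ) : Set where
  field
    adj     : Fin n → Fin n → Bool
    adj-sym : ∀ u w → adj u w ≡ adj w u
    adj-irr : ∀ u → adj u u ≡ false
open Graph public

countTrue : ∀ {k} → (Fin k → Bool) → ℕ
countTrue {zero}  f = 0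
countTrue {suc k} f = (if f zero then 1 else 0) + countTrue (λ i → f (suc i))

sumFin : ∀ {k} → (Fin k → ℕ) → ℕ
sumFin {zero}  f = 0
sumFin {suc k} f = f zero + sumFin (λ i → f (suc i))

VColoring : ℕ → Set
VColoring n = Fin n → Bool

paint : ∀ {n} → VColoring n → Fin n → VColoring n
paint S w x = S x ∨ does (x ≟ w)

-- u (of any colour) may force w if w is the only white neighbour of u
SkewForce : ∀ {n} → Graph n → VColoring n → Fin n → Fin n → Set
SkewForce G S u w =
  (adj G u w ≡ true) × (S w ≡ false) ×
  (∀ x → adj G u x ≡ true → ¬ (x ≡ w) → S x ≡ true)

data SkewForcing {n} (G : Graph n) : VColoring n → Set where
  done : ∀ S → (∀ x → S x ≡ true) → SkewForcing G S
  step : ∀ S u w → SkewForce G S u w → SkewForcing G (paint S w) →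
         SkewForcing G S

IsZminus : ∀ {n} → Graph n → ℕ → Set
IsZminus {n} G k =
  (Σ (VColoring n) λ S → SkewForcing G S × countTrue S ≡ k) ×
  (∀ S → SkewForcing G S → k ≤ countTrue S)

-- r-blowup and r-fold forcing
-- vertices of G^(r) are pairs (u , i) with u : Fin n (cluster R_u), i : Fin r;
-- (u , i) ~ (w , j) iff u ~ w in G.

BColoring : ℕ → ℕ → Set
BColoring n r = Fin n → Fin r → Bool

blueIn : ∀ {n r} → BColoring n r → Fin n → ℕ
blueIn C w = countTrue (C w)

whiteIn : ∀ {n r} → BColoring n r → Fin n → ℕ
whiteIn C w = countTrue (λ j → not (C w j))

card : ∀ {n r} → BColoring n r → ℕ
card C = sumFin (blueIn C)

-- |N((u,i)) \ B_t| (independent of i)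
whiteNbrs : ∀ {n r} → Graph n → BColoring n r → Fin n → ℕ
whiteNbrs G C u = sumFin (λ w → if adj G u w then whiteIn C w else 0)

forceAt : ∀ {n r} → Graph n → BColoring n r → Fin n → BColoring n r
forceAt G C u w j = C w j ∨ adj G u w

data RProcess {n} (G : Graph n) (r : ℕ)
              (Ok : BColoring n r → Fin n → Set) : BColoring n r → Set where
  done : ∀ C → (∀ w j → C w j ≡ true) → RProcess G r Ok C
  step : ∀ C u i → C u i ≡ true → whiteNbrs G C u ≤ r → Ok C u →
         RProcess G r Ok (forceAt G C u) → RProcess G r Ok C

NoCondition : ∀ {n r} → BColoring n r → Fin n → Set
NoCondition _ _ = ⊤

RFoldForcing : ∀ {n} → Graph n → (r : ℕ) → BColoring n r → Set
RFoldForcing G r B = RProcess G r NoCondition B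

IsMinRFold : ∀ {n} → Graph n → (r : ℕ) → BColoring n r → Set
IsMinRFold {n} G r B =
  RFoldForcing G r B × (∀ B' → RFoldForcing G r B' → card B ≤ card B')

-- every cluster is All (r blue), Most (r-1 blue, r ≥ 3), One (1 blue) or None
-- (0 blue).  (For r ≤ 2, r ∸ 1 is 0 or 1, i.e. None or One, so allowing
-- count r ∸ 1 is harmless.)
IsAMON : ∀ {n r} → BColoring n r → Set
IsAMON {n} {r} B = ∀ w →
  (blueIn B w ≡ r) ⊎ ((3 ≤ r) × (blueIn B w ≡ r ∸ 1)) ⊎
  (blueIn B w ≡ 1) ⊎ (blueIn B w ≡ 0)

aB : ∀ {n r} → BColoring n r → ℕ
aB {n} {r} B = countTrue (λ w → does (blueIn B w Data.Nat.≟ r))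

mB : ∀ {n r} → BColoring n r → ℕ
mB {n} {r} B =
  countTrue (λ w → does (3 Data.Nat.≤? r) Data.Bool.∧ does (blueIn B w Data.Nat.≟ (r ∸ 1)))

forcedClusters : ∀ {n r} → Graph n → BColoring n r → Fin n → List (Fin n)
forcedClusters {n} G C u =
  filter (λ w → T? (adj G u w Data.Bool.∧ Data.Bool.not (does (whiteIn C w Data.Nat.≟ 0))))
         (allFin n)

-- step condition relative to the initial set B: exactly one cluster forced, or
-- exactly two, one a One cluster and the other a Most cluster of B
-- (for r = 2: two One clusters, which is the case r ∸ 1 = 1)
OptimalStep : ∀ {n r} → Graph n → BColoring n r → BColoring n r → Fin n → Set
OptimalStep {n} {r} G B C u =
  (length (forcedClusters G C u) ≡ 1) ⊎
  (Σ (Fin n) λ w₁ → Σ (Fin n) λ w₂ →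
     (forcedClusters G C u ≡ w₁ ∷ w₂ ∷ []) × (2 ≤ r) ×
     (((blueIn B w₁ ≡ 1) × (blueIn B w₂ ≡ r ∸ 1)) ⊎
      ((blueIn B w₁ ≡ r ∸ 1) × (blueIn B w₂ ≡ 1))))

IsOptimalAMON : ∀ {n} → Graph n → (r : ℕ) → BColoring n r → Set
IsOptimalAMON G r B =
  IsAMON B × IsMinRFold G r B × RProcess G r (OptimalStep G B) B

-- The All and Most clusters of B form a skew forcing set of size a + m: along the optimal
-- process, a step from cluster u forces one cluster w, and every other neighbouring cluster of u
-- that is not yet full is a Most cluster (for r ≤ 2 a two-cluster step is impossible since n ≤ r),
-- so u skew-forces w in G.  Conversely, a skew forcing process from S lifts to an r-fold forcing
-- set made of the clusters of S plus one vertex in the cluster of each white forcer; it has at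
-- most r s + x vertices with s + x < n ≤ r (or S = V).  Comparing it with |B| ≥ r a + (r − 1) m + ℓ
-- gives a + m ≤ s unless a = ℓ = 0.  In that last case every optimal step forces a single
-- cluster, so a Most cluster could be replaced by a single blue vertex, contradicting minimality.

module Submission where

open import Defs
open import Data.Nat using (ℕ; zero; suc; _+_; _*_; _∸_; _≤_; _<_; z≤n; s≤s; _≤?_)
  renaming (_≟_ to _≟ℕ_)
open import Data.Nat.Properties hiding (_≟_)
open import Data.Fin using (Fin; zero; suc; _≟_)
import Data.Fin.Properties as Fin
open import Data.Nat.Solver using (module +-*-Solver)
open import Function using (_∘_; id)
open import Data.Bool using (Bool; true; false; if_then_else_; _∨_; _∧_; not; T)
open import Data.Bool.Properties using (∨-identityʳ; ∨-zeroʳ; ∨-conicalˡ)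
open import Data.Product using (Σ; ∃; _×_; _,_; proj₁; proj₂)
open import Data.Sum using (_⊎_; inj₁; inj₂; [_,_])
import Data.Sum as Sum
open import Data.Empty using (⊥; ⊥-elim)
open import Data.Unit using (tt)
open import Data.List using ([]; _∷_; allFin; length)
open import Data.List.Membership.Propositional using (_∈_)
open import Data.List.Membership.Propositional.Properties using (∈-filter⁺; ∈-filter⁻; ∈-allFin)
open import Data.List.Relation.Unary.Any using (here; there)
open import Data.List.Relation.Unary.All using ([]; _∷_)
open import Data.List.Relation.Unary.AllPairs using (_∷_)
open import Data.List.Relation.Unary.Unique.Propositional using (Unique)
import Data.List.Relation.Unary.Unique.Propositional.Properties as Unique
open import Data.Vec using ([]; _∷_; lookup)
open import Relation.Nullary using (does; ¬_; yes; no; contradiction)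
open import Relation.Nullary.Decidable using (dec-true; dec-false)
open import Relation.Binary.PropositionalEquality hiding ([_])

∨-true⁻ : ∀ a {b} → a ∨ b ≡ true → a ≡ true ⊎ b ≡ true
∨-true⁻ true  _ = inj₁ refl
∨-true⁻ false p = inj₂ p

∨-trueˡ : ∀ {a} b → a ≡ true → a ∨ b ≡ true
∨-trueˡ _ refl = refl

∨-trueʳ : ∀ a {b} → b ≡ true → a ∨ b ≡ true
∨-trueʳ a refl = ∨-zeroʳ a

∧-true⁻ : ∀ a {b} → a ∧ b ≡ true → a ≡ true × b ≡ true
∧-true⁻ true p = refl , p

∧-true⁺ : ∀ {a b} → a ≡ true → b ≡ true → a ∧ b ≡ true
∧-true⁺ refl refl = refl

true≢false : true ≢ false
true≢false ()

does-true⁻ : ∀ {P : Set} (d : Relation.Nullary.Dec P) → does d ≡ true → P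
does-true⁻ (yes p) _ = p

if≤ : ∀ b m → (if b then m else 0) ≤ m
if≤ true  m = ≤-refl
if≤ false m = z≤n

∈-pair : ∀ {A : Set} {x a b : A} → x ∈ a ∷ b ∷ [] → x ≡ a ⊎ x ≡ b
∈-pair (here x≡a)         = inj₁ x≡a
∈-pair (there (here x≡b)) = inj₂ x≡b

r≢r∸1 : ∀ {r} → 1 ≤ r → r ≢ r ∸ 1
r≢r∸1 {suc r} _ = 1+n≢n

no-three-distinct : ∀ {n} → n ≤ 2 → (a b c : Fin n) → a ≢ b → a ≢ c → b ≢ c → ⊥
no-three-distinct n≤2 a b c a≢b a≢c b≢c with Fin.pigeonhole (s≤s n≤2) (lookup (a ∷ b ∷ c ∷ []))
... | zero     , suc zero       , _ , a≡b = a≢b a≡b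
... | zero     , suc (suc zero) , _ , a≡c = a≢c a≡c
... | suc zero , suc (suc zero) , _ , b≡c = b≢c b≡c
... | suc zero , suc zero , s≤s () , _
... | suc (suc zero) , suc (suc zero) , s≤s (s≤s ()) , _

countTrue-cong : ∀ {k} {f g : Fin k → Bool} → (∀ i → f i ≡ g i) → countTrue f ≡ countTrue g
countTrue-cong {zero}  eq = refl
countTrue-cong {suc k} eq =
  cong₂ _+_ (cong (λ b → if b then 1 else 0) (eq zero)) (countTrue-cong (λ i → eq (suc i)))

countTrue-none : ∀ {k} {f : Fin k → Bool} → (∀ i → f i ≡ false) → countTrue f ≡ 0
countTrue-none {zero}  none = refl
countTrue-none {suc k} none rewrite none zero = countTrue-none (λ i → none (suc i))

countTrue≡0⇒none : ∀ {k} (f : Fin k → Bool) → countTrue f ≡ 0 → ∀ i → f i ≡ false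
countTrue≡0⇒none {suc k} f c≡0 i with f zero in f₀
countTrue≡0⇒none {suc k} f c≡0 zero    | false = f₀
countTrue≡0⇒none {suc k} f c≡0 (suc i) | false = countTrue≡0⇒none (λ i → f (suc i)) c≡0 i

countTrue≢0⇒some : ∀ {k} (f : Fin k → Bool) → countTrue f ≢ 0 → ∃ λ i → f i ≡ true
countTrue≢0⇒some {zero}  f c≢0 = contradiction refl c≢0
countTrue≢0⇒some {suc k} f c≢0 with f zero in f₀
... | true  = zero , f₀
... | false with countTrue≢0⇒some (λ i → f (suc i)) c≢0
...   | i , fi = suc i , fi

countTrue≤ : ∀ {k} (f : Fin k → Bool) → countTrue f ≤ k
countTrue≤ {zero}  f = z≤n
countTrue≤ {suc k} f with f zero
... | true  = s≤s (countTrue≤ (λ i → f (suc i)))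
... | false = m≤n⇒m≤1+n (countTrue≤ (λ i → f (suc i)))

countTrue-all : ∀ {k} {f : Fin k → Bool} → (∀ i → f i ≡ true) → countTrue f ≡ k
countTrue-all {zero}  all = refl
countTrue-all {suc k} all rewrite all zero = cong suc (countTrue-all (λ i → all (suc i)))

countTrue-mono : ∀ {k} (f g : Fin k → Bool) → (∀ i → f i ≡ true → g i ≡ true) →
                 countTrue f ≤ countTrue g
countTrue-mono {zero}  f g f⊆g = z≤n
countTrue-mono {suc k} f g f⊆g with f zero in f₀ | g zero in g₀
... | true  | true  = s≤s (countTrue-mono _ _ (λ i → f⊆g (suc i)))
... | true  | false = contradiction (trans (sym (f⊆g zero f₀)) g₀) true≢false
... | false | true  = m≤n⇒m≤1+n (countTrue-mono _ _ (λ i → f⊆g (suc i)))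
... | false | false = countTrue-mono _ _ (λ i → f⊆g (suc i))

countTrue-∨ : ∀ {k} (f g : Fin k → Bool) → (∀ i → f i ≡ true → g i ≡ true → ⊥) →
              countTrue (λ i → f i ∨ g i) ≡ countTrue f + countTrue g
countTrue-∨ {zero}  f g disj = refl
countTrue-∨ {suc k} f g disj with f zero in f₀ | g zero in g₀
... | true  | true  = ⊥-elim (disj zero f₀ g₀)
... | true  | false = cong suc (countTrue-∨ _ _ (λ i → disj (suc i)))
... | false | true  = trans (cong suc (countTrue-∨ _ _ (λ i → disj (suc i)))) (sym (+-suc _ _))
... | false | false = countTrue-∨ _ _ (λ i → disj (suc i))

countTrue-singleton : ∀ {k} (w : Fin k) → countTrue (λ x → does (x ≟ w)) ≡ 1
countTrue-singleton {suc k} zero    = cong suc (countTrue-none {k} (λ _ → refl))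
countTrue-singleton {suc k} (suc w) = countTrue-singleton w

sumFin-none : ∀ {k} {f : Fin k → ℕ} → (∀ i → f i ≡ 0) → sumFin f ≡ 0
sumFin-none {zero}  none = refl
sumFin-none {suc k} none = cong₂ _+_ (none zero) (sumFin-none (λ i → none (suc i)))

sumFin-single : ∀ {k} (f : Fin k → ℕ) w → (∀ x → x ≢ w → f x ≡ 0) → sumFin f ≡ f w
sumFin-single {suc k} f zero    rest =
  trans (cong (f zero +_) (sumFin-none (λ i → rest (suc i) (λ ())))) (+-identityʳ _)
sumFin-single {suc k} f (suc w) rest =
  cong₂ _+_ (rest zero (λ ()))
            (sumFin-single (λ i → f (suc i)) w (λ x x≢w → rest (suc x) (x≢w ∘ Fin.suc-injective)))

sumFin-+ : ∀ {k} (f g : Fin k → ℕ) → sumFin (λ i → f i + g i) ≡ sumFin f + sumFin g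
sumFin-+ {zero}  f g = refl
sumFin-+ {suc k} f g = begin
  (f zero + g zero) + sumFin (λ i → f (suc i) + g (suc i))
    ≡⟨ cong (f zero + g zero +_) (sumFin-+ (λ i → f (suc i)) (λ i → g (suc i))) ⟩
  (f zero + g zero) + (sumFin (λ i → f (suc i)) + sumFin (λ i → g (suc i)))
    ≡⟨ +-*-Solver.solve 4 (λ a b c d → (a :+ b) :+ (c :+ d) := (a :+ c) :+ (b :+ d)) refl
         (f zero) (g zero) (sumFin (λ i → f (suc i))) (sumFin (λ i → g (suc i))) ⟩
  (f zero + sumFin (λ i → f (suc i))) + (g zero + sumFin (λ i → g (suc i))) ∎
  where open ≡-Reasoning
        open +-*-Solver

sumFin-if : ∀ {k} (c : ℕ) (f : Fin k → Bool) → sumFin (λ i → if f i then c else 0) ≡ c * countTrue f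
sumFin-if {zero}  c f = sym (*-zeroʳ c)
sumFin-if {suc k} c f with f zero
... | true  = trans (cong (c +_) (sumFin-if c (λ i → f (suc i)))) (sym (*-suc c _))
... | false = sumFin-if c (λ i → f (suc i))

sumFin-mono : ∀ {k} (f g : Fin k → ℕ) → (∀ i → f i ≤ g i) → sumFin f ≤ sumFin g
sumFin-mono {zero}  f g f≤g = z≤n
sumFin-mono {suc k} f g f≤g = +-mono-≤ (f≤g zero) (sumFin-mono _ _ (λ i → f≤g (suc i)))

sumFin-strict : ∀ {k} (f g : Fin k → ℕ) → (∀ i → f i ≤ g i) → ∀ u → f u < g u → sumFin f < sumFin g
sumFin-strict {suc k} f g f≤g zero    fu<gu = +-mono-<-≤ fu<gu (sumFin-mono _ _ (λ i → f≤g (suc i)))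
sumFin-strict {suc k} f g f≤g (suc u) fu<gu =
  +-mono-≤-< (f≤g zero) (sumFin-strict _ _ (λ i → f≤g (suc i)) u fu<gu)

paint-target : ∀ {k} (S : Fin k → Bool) w → paint S w w ≡ true
paint-target S w = ∨-trueʳ (S w) (dec-true (w ≟ w) refl)

paint-⊇ : ∀ {k} (S : Fin k → Bool) w x → S x ≡ true → paint S w x ≡ true
paint-⊇ S w x = ∨-trueˡ _

paint⁻ : ∀ {k} (S : Fin k → Bool) w x → paint S w x ≡ true → S x ≡ true ⊎ x ≡ w
paint⁻ S w x p = Sum.map₂ (does-true⁻ (x ≟ w)) (∨-true⁻ (S x) p)

countTrue-paint : ∀ {k} (S : Fin k → Bool) w → S w ≡ false → countTrue (paint S w) ≡ suc (countTrue S)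
countTrue-paint S w w∉S = begin
  countTrue (paint S w)                            ≡⟨ countTrue-∨ S (λ x → does (x ≟ w)) disjoint ⟩
  countTrue S + countTrue (λ x → does (x ≟ w))     ≡⟨ cong (countTrue S +_) (countTrue-singleton w) ⟩
  countTrue S + 1                                  ≡⟨ +-comm _ 1 ⟩
  suc (countTrue S)                                ∎
  where
  open ≡-Reasoning
  disjoint : ∀ x → S x ≡ true → does (x ≟ w) ≡ true → ⊥
  disjoint x x∈S x≡w with refl ← does-true⁻ (x ≟ w) x≡w = true≢false (trans (sym x∈S) w∉S)

countTrue-paint≤ : ∀ {k} (S : Fin k → Bool) w → countTrue (paint S w) ≤ suc (countTrue S)
countTrue-paint≤ S w with S w in w∈S
... | false = ≤-reflexive (countTrue-paint S w w∈S)
... | true  = m≤n⇒m≤1+n (countTrue-mono (paint S w) S paint⊆S)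
  where
  paint⊆S : ∀ x → paint S w x ≡ true → S x ≡ true
  paint⊆S x p with paint⁻ S w x p
  ... | inj₁ x∈S = x∈S
  ... | inj₂ refl = w∈S

module _ {n r : ℕ} where

  Full : BColoring n r → Fin n → Set
  Full C x = whiteIn C x ≡ 0

  full⇒blue : ∀ (C : BColoring n r) x → Full C x → ∀ j → C x j ≡ true
  full⇒blue C x full j with C x j in blue
  ... | true  = refl
  ... | false = ⊥-elim (true≢false (trans (sym (cong not blue)) (countTrue≡0⇒none (λ j → not (C x j)) full j)))

  blue⇒full : ∀ (C : BColoring n r) x → (∀ j → C x j ≡ true) → Full C x
  blue⇒full C x blue = countTrue-none (λ j → cong not (blue j))

  Full-cong : ∀ (C D : BColoring n r) x → (∀ j → D x j ≡ C x j) → Full C x → Full D x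
  Full-cong C D x D≡C = trans (countTrue-cong {f = λ j → not (D x j)} (λ j → cong not (D≡C j)))

  whiteIn-anti : ∀ (C D : BColoring n r) x → (∀ j → C x j ≡ true → D x j ≡ true) →
                 whiteIn D x ≤ whiteIn C x
  whiteIn-anti C D x C⊆D = countTrue-mono _ _ white
    where
    white : ∀ j → not (D x j) ≡ true → not (C x j) ≡ true
    white j Dxj-white with C x j in Cxj
    ... | false = refl
    ... | true  = ⊥-elim (true≢false (trans (sym Dxj-white) (cong not (C⊆D j Cxj))))

module _ {n : ℕ} (G : Graph n) where

  adj⇒≢ : ∀ {u w} → adj G u w ≡ true → u ≢ w
  adj⇒≢ {u} a refl = true≢false (trans (sym a) (adj-irr G u))

  module _ {r : ℕ} where

    forceAt-full : ∀ (C : BColoring n r) {u x} → adj G u x ≡ true → Full (forceAt G C u) x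
    forceAt-full C {u} {x} a = blue⇒full (forceAt G C u) x (λ j → ∨-trueʳ (C x j) a)

    forceAt-full⁻ : ∀ (C : BColoring n r) u x → Full (forceAt G C u) x → adj G u x ≡ true ⊎ Full C x
    forceAt-full⁻ C u x full with adj G u x
    ... | true  = inj₁ refl
    ... | false = inj₂ (trans (countTrue-cong (λ j → cong not (sym (∨-identityʳ (C x j))))) full)

    ∈-forcedClusters⁺ : ∀ (C : BColoring n r) {u x} → adj G u x ≡ true → ¬ Full C x →
                        x ∈ forcedClusters G C u
    ∈-forcedClusters⁺ C {u} {x} a ¬full = ∈-filter⁺ _ (∈-allFin x)
      (subst₂ (λ b c → T (b ∧ not c)) (sym a) (sym (dec-false (whiteIn C x ≟ℕ 0) ¬full)) tt)

    ∈-forcedClusters⁻ : ∀ (C : BColoring n r) {u x} → x ∈ forcedClusters G C u → adj G u x ≡ true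
    ∈-forcedClusters⁻ C {u} {x} x∈ with adj G u x | proj₂ (∈-filter⁻ _ {xs = allFin n} x∈)
    ... | true | _ = refl

    forcedClusters-unique : ∀ (C : BColoring n r) u → Unique (forcedClusters G C u)
    forcedClusters-unique C u = Unique.filter⁺ _ (Unique.allFin⁺ n)

    whiteNbrs≤ : ∀ (C : BColoring n r) u z → (∀ x → adj G u x ≡ true → x ≢ z → Full C x) →
                 whiteNbrs G C u ≤ r
    whiteNbrs≤ C u z others-full = begin
      whiteNbrs G C u  ≡⟨ sumFin-single white z only-z ⟩
      white z          ≤⟨ if≤ (adj G u z) (whiteIn C z) ⟩
      whiteIn C z      ≤⟨ countTrue≤ _ ⟩
      r                ∎
      where
      open ≤-Reasoning
      white : Fin n → ℕ
      white x = if adj G u x then whiteIn C x else 0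
      only-z : ∀ x → x ≢ z → white x ≡ 0
      only-z x x≢z with adj G u x in a
      ... | true  = others-full x a x≢z
      ... | false = refl

    whiteNbrs-anti : ∀ (C D : BColoring n r) u → (∀ x j → C x j ≡ true → D x j ≡ true) →
                     whiteNbrs G D u ≤ whiteNbrs G C u
    whiteNbrs-anti C D u C⊆D = sumFin-mono _ _ pointwise
      where
      pointwise : ∀ x → (if adj G u x then whiteIn D x else 0) ≤ (if adj G u x then whiteIn C x else 0)
      pointwise x with adj G u x
      ... | true  = whiteIn-anti C D x (C⊆D x)
      ... | false = ≤-refl

    RFoldForcing-mono : ∀ {C D : BColoring n r} → (∀ x j → C x j ≡ true → D x j ≡ true) →
                        RFoldForcing G r C → RFoldForcing G r D
    RFoldForcing-mono {D = D} C⊆D (done C all) = done D (λ x j → C⊆D x j (all x j))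
    RFoldForcing-mono {D = D} C⊆D (step C u i blue ≤r _ rest) =
      step D u i (C⊆D u i blue) (≤-trans (whiteNbrs-anti C D u C⊆D) ≤r) tt
           (RFoldForcing-mono (λ x j p → [ (λ q → ∨-trueˡ _ (C⊆D x j q)) , ∨-trueʳ _ ]
                                           (∨-true⁻ (C x j) p)) rest)

    record ForcesInto (P : Fin n → Set) (C : BColoring n r) (u : Fin n) : Set where
      field
        target     : Fin n
        target-adj : adj G u target ≡ true
        others     : ∀ x → adj G u x ≡ true → ¬ Full C x → x ≡ target ⊎ P x

    forcesInto : ∀ {P C u} w → w ∈ forcedClusters G C u →
                 (∀ x → x ∈ forcedClusters G C u → x ≡ w ⊎ P x) → ForcesInto P C u
    forcesInto {C = C} w w∈ classify = record
      { target     = w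
      ; target-adj = ∈-forcedClusters⁻ C w∈
      ; others     = λ x a ¬full → classify x (∈-forcedClusters⁺ C a ¬full)
      }

    forcesInto-single : ∀ {P C u} → length (forcedClusters G C u) ≡ 1 → ForcesInto P C u
    forcesInto-single {C = C} {u} len with forcedClusters G C u in fc
    ... | z ∷ [] = forcesInto z (subst (z ∈_) (sym fc) (here refl)) only-z
      where
      only-z : ∀ x → x ∈ forcedClusters G C u → x ≡ z ⊎ _
      only-z x x∈ with subst (x ∈_) fc x∈
      ... | here x≡z = inj₁ x≡z

    forcesInto-pair : ∀ {P C u w₁ w₂} → forcedClusters G C u ≡ w₁ ∷ w₂ ∷ [] → P w₁ ⊎ P w₂ →
                      ForcesInto P C u
    forcesInto-pair {C = C} {u} {w₁} {w₂} fc (inj₂ Pw₂) =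
      forcesInto w₁ (subst (w₁ ∈_) (sym fc) (here refl))
        (λ x x∈ → Sum.map₂ (λ { refl → Pw₂ }) (∈-pair (subst (x ∈_) fc x∈)))
    forcesInto-pair {C = C} {u} {w₁} {w₂} fc (inj₁ Pw₁) =
      forcesInto w₂ (subst (w₂ ∈_) (sym fc) (there (here refl)))
        (λ x x∈ → Sum.swap (Sum.map₁ (λ { refl → Pw₁ }) (∈-pair (subst (x ∈_) fc x∈))))

    forcedPair-distinct : ∀ C {u w₁ w₂} → forcedClusters G C u ≡ w₁ ∷ w₂ ∷ [] →
                          u ≢ w₁ × u ≢ w₂ × w₁ ≢ w₂
    forcedPair-distinct C {u} {w₁} {w₂} fc with subst Unique fc (forcedClusters-unique C u)
    ... | (w₁≢w₂ ∷ []) ∷ _ =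
      adj⇒≢ (∈-forcedClusters⁻ C (subst (w₁ ∈_) (sym fc) (here refl))) ,
      adj⇒≢ (∈-forcedClusters⁻ C (subst (w₂ ∈_) (sym fc) (there (here refl)))) ,
      w₁≢w₂

module _ {n r : ℕ} (B : BColoring n r) where

  -- As in mB, One clusters are only counted for r ≥ 3; for r = 1 they would be All clusters.
  isAll isMost isOne : Fin n → Bool
  isAll  w = does (blueIn B w ≟ℕ r)
  isMost w = does (3 ≤? r) ∧ does (blueIn B w ≟ℕ (r ∸ 1))
  isOne  w = does (3 ≤? r) ∧ does (blueIn B w ≟ℕ 1)

  isAll⁻ : ∀ {w} → isAll w ≡ true → blueIn B w ≡ r
  isAll⁻ {w} = does-true⁻ (blueIn B w ≟ℕ r)

  isMost⁺ : ∀ {w} → 3 ≤ r → blueIn B w ≡ r ∸ 1 → isMost w ≡ true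
  isMost⁺ {w} 3≤r most = ∧-true⁺ (dec-true (3 ≤? r) 3≤r) (dec-true (blueIn B w ≟ℕ (r ∸ 1)) most)

  isMost⁻ : ∀ {w} → isMost w ≡ true → 3 ≤ r × blueIn B w ≡ r ∸ 1
  isMost⁻ {w} p with ∧-true⁻ (does (3 ≤? r)) p
  ... | 3≤r , most = does-true⁻ (3 ≤? r) 3≤r , does-true⁻ (blueIn B w ≟ℕ (r ∸ 1)) most

  isOne⁺ : ∀ {w} → 3 ≤ r → blueIn B w ≡ 1 → isOne w ≡ true
  isOne⁺ {w} 3≤r one = ∧-true⁺ (dec-true (3 ≤? r) 3≤r) (dec-true (blueIn B w ≟ℕ 1) one)

  isOne⁻ : ∀ {w} → isOne w ≡ true → 3 ≤ r × blueIn B w ≡ 1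
  isOne⁻ {w} p with ∧-true⁻ (does (3 ≤? r)) p
  ... | 3≤r , one = does-true⁻ (3 ≤? r) 3≤r , does-true⁻ (blueIn B w ≟ℕ 1) one

  isAll⇒¬isMost : ∀ w → isAll w ≡ true → isMost w ≡ true → ⊥
  isAll⇒¬isMost w all most with isMost⁻ most
  ... | 3≤r , v≡r∸1 = r≢r∸1 (≤-trans (s≤s z≤n) 3≤r) (trans (sym (isAll⁻ all)) v≡r∸1)

  allOrMost : Fin n → Bool
  allOrMost w = isAll w ∨ isMost w

  countTrue-allOrMost : countTrue allOrMost ≡ aB B + mB B
  countTrue-allOrMost = countTrue-∨ isAll isMost isAll⇒¬isMost

  a+m≤n : aB B + mB B ≤ n
  a+m≤n = subst (_≤ n) countTrue-allOrMost (countTrue≤ allOrMost)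

  weight : Fin n → ℕ
  weight w = (if isAll w then r else 0) + ((if isMost w then r ∸ 1 else 0) + (if isOne w then 1 else 0))

  weight≤blueIn : ∀ w → weight w ≤ blueIn B w
  weight≤blueIn w with isAll w in all | isMost w in most | isOne w in one
  ... | true  | true  | _     = ⊥-elim (isAll⇒¬isMost w all most)
  ... | true  | false | true  = let 3≤r , v≡1 = isOne⁻ one in
    contradiction (subst (3 ≤_) (trans (sym (isAll⁻ all)) v≡1) 3≤r) λ { (s≤s ()) }
  ... | true  | false | false = ≤-reflexive (trans (+-identityʳ r) (sym (isAll⁻ all)))
  ... | false | true  | true  = let 3≤r , v≡r∸1 = isMost⁻ most ; _ , v≡1 = isOne⁻ one in
    contradiction (subst (2 ≤_) (trans (sym v≡r∸1) v≡1) (∸-monoˡ-≤ 1 3≤r)) λ { (s≤s ()) }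
  ... | false | true  | false = ≤-reflexive (trans (+-identityʳ (r ∸ 1)) (sym (proj₂ (isMost⁻ most))))
  ... | false | false | true  = ≤-reflexive (sym (proj₂ (isOne⁻ one)))
  ... | false | false | false = z≤n

  sumFin-weight : sumFin weight ≡ r * aB B + ((r ∸ 1) * mB B + countTrue isOne)
  sumFin-weight =
    trans (sumFin-+ (λ w → if isAll w then r else 0) _)
      (cong₂ _+_ (sumFin-if r isAll)
        (trans (sumFin-+ (λ w → if isMost w then r ∸ 1 else 0) _)
          (cong₂ _+_ (sumFin-if (r ∸ 1) isMost) (trans (sumFin-if 1 isOne) (*-identityˡ _)))))

  card-lowerBound : r * aB B + ((r ∸ 1) * mB B + countTrue isOne) ≤ card B
  card-lowerBound = subst (_≤ card B) sumFin-weight (sumFin-mono weight (blueIn B) weight≤blueIn)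

module _ {n r : ℕ} (G : Graph n) (B : BColoring n r) where

  optimalStep⇒forcesIntoMost : n ≤ r → ∀ {C u} → OptimalStep G B C u →
                               ForcesInto G (λ x → isMost B x ≡ true) C u
  optimalStep⇒forcesIntoMost n≤r (inj₁ len) = forcesInto-single G len
  optimalStep⇒forcesIntoMost n≤r {C} (inj₂ (w₁ , w₂ , fc , _ , kinds)) with 3 ≤? r
  ... | yes 3≤r = forcesInto-pair G fc
                    (Sum.swap (Sum.map (isMost⁺ B 3≤r ∘ proj₂) (isMost⁺ B 3≤r ∘ proj₁) kinds))
  -- for r ≤ 2 the forcer and the two forced clusters would be three distinct vertices, but n ≤ 2
  ... | no ¬3≤r with forcedPair-distinct G C fc
  ...   | u≢w₁ , u≢w₂ , w₁≢w₂ =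
    ⊥-elim (no-three-distinct (≤-trans n≤r (≤-pred (≰⇒> ¬3≤r))) _ w₁ w₂ u≢w₁ u≢w₂ w₁≢w₂)

  optimalStep⇒forcesInto : (∀ w → blueIn B w ≢ 1) → ∀ {C u} → OptimalStep G B C u →
                           ForcesInto G (λ _ → ⊥) C u
  optimalStep⇒forcesInto noOne (inj₁ len) = forcesInto-single G len
  optimalStep⇒forcesInto noOne (inj₂ (_ , _ , _ , _ , inj₁ (one₁ , _))) = ⊥-elim (noOne _ one₁)
  optimalStep⇒forcesInto noOne (inj₂ (_ , _ , _ , _ , inj₂ (_ , one₂))) = ⊥-elim (noOne _ one₂)

  skewForcing-along : n ≤ r → ∀ {C} → RProcess G r (OptimalStep G B) C → ∀ T →
                      (∀ x → Full C x → T x ≡ true) → (∀ x → isMost B x ≡ true → T x ≡ true) →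
                      SkewForcing G T
  skewForcing-along n≤r (done C all) T full⊆T most⊆T = done T (λ x → full⊆T x (blue⇒full C x (all x)))
  skewForcing-along n≤r (step C u _ _ _ ok rest) T full⊆T most⊆T = continue (T w) refl
    where
    open ForcesInto (optimalStep⇒forcesIntoMost n≤r ok) renaming (target to w)

    classify : ∀ x → adj G u x ≡ true → x ≡ w ⊎ T x ≡ true
    classify x a with whiteIn C x ≟ℕ 0
    ... | yes full = inj₂ (full⊆T x full)
    ... | no ¬full = Sum.map₂ (most⊆T x) (others x a ¬full)

    full⊆ : ∀ T′ → (∀ x → T x ≡ true → T′ x ≡ true) → T′ w ≡ true →
            ∀ x → Full (forceAt G C u) x → T′ x ≡ true
    full⊆ T′ T⊆T′ w∈T′ x full with forceAt-full⁻ G C u x full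
    ... | inj₂ fullC = T⊆T′ x (full⊆T x fullC)
    ... | inj₁ a     = [ (λ { refl → w∈T′ }) , T⊆T′ x ] (classify x a)

    continue : ∀ b → T w ≡ b → SkewForcing G T
    continue true  w∈T = skewForcing-along n≤r rest T (full⊆ T (λ _ p → p) w∈T) most⊆T
    continue false w∉T =
      step T u w (target-adj , w∉T , λ x a x≢w → [ (λ x≡w → contradiction x≡w x≢w) , id ] (classify x a))
        (skewForcing-along n≤r rest (paint T w)
          (full⊆ (paint T w) (paint-⊇ T w) (paint-target T w))
          (λ x most → paint-⊇ T w x (most⊆T x most)))

  allOrMost-skewForcing : n ≤ r → RProcess G r (OptimalStep G B) B → SkewForcing G (allOrMost B)
  allOrMost-skewForcing n≤r process = skewForcing-along n≤r process (allOrMost B)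
    (λ x full → ∨-trueˡ _ (dec-true (blueIn B x ≟ℕ r) (countTrue-all (full⇒blue B x full))))
    (λ x most → ∨-trueʳ (isAll B x) most)

module _ {n : ℕ} (G : Graph n) {q : ℕ} where

  -- S: full clusters; X: the white vertices that perform a skew force, each given the blue vertex
  -- zero of its cluster to force from.
  lift : VColoring n → VColoring n → BColoring n (suc q)
  lift S X x j = S x ∨ (X x ∧ does (j ≟ zero))

  card-lift : ∀ S X → card (lift S X) ≤ suc q * countTrue S + countTrue X
  card-lift S X = subst (card (lift S X) ≤_) decomposition (sumFin-mono _ _ pointwise)
    where
    pointwise : ∀ x → blueIn (lift S X) x ≤ (if S x then suc q else 0) + (if X x then 1 else 0)
    pointwise x with S x | X x
    ... | true  | b     = ≤-trans (countTrue≤ (λ j → true ∨ (b ∧ does (j ≟ zero)))) (m≤m+n (suc q) _)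
    ... | false | true  = ≤-reflexive (countTrue-singleton {suc q} zero)
    ... | false | false = ≤-reflexive (countTrue-none {suc q} {λ _ → false} (λ _ → refl))
    decomposition : sumFin (λ x → (if S x then suc q else 0) + (if X x then 1 else 0)) ≡
                    suc q * countTrue S + countTrue X
    decomposition = trans (sumFin-+ (λ x → if S x then suc q else 0) _)
                      (cong₂ _+_ (sumFin-if (suc q) S) (trans (sumFin-if 1 X) (*-identityˡ _)))

  record LiftedForcing (S : VColoring n) : Set where
    field
      extra          : VColoring n
      extra-disjoint : ∀ x → extra x ≡ true → S x ≡ false
      small          : (∀ x → S x ≡ true) ⊎ countTrue extra + countTrue S < n
      forcing        : RFoldForcing G (suc q) (lift S extra)

  liftedForcing : ∀ {S} → SkewForcing G S → LiftedForcing S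
  liftedForcing (done S all) = record
    { extra          = λ _ → false
    ; extra-disjoint = λ _ ()
    ; small          = inj₁ all
    ; forcing        = done _ (λ x j → ∨-trueˡ _ (all x))
    }
  liftedForcing (step S u w (a , w∉S , nbrs∈S) rest) = continue (S u) refl
    where
    open LiftedForcing (liftedForcing rest) renaming
      (extra to X₁; extra-disjoint to X₁-disjoint; small to small₁; forcing to forcing₁)

    forcing-with : ∀ X → (∀ x → X₁ x ≡ true → X x ≡ true) → S u ≡ true ⊎ X u ≡ true →
                   RFoldForcing G (suc q) (lift S X)
    forcing-with X X₁⊆X u-blue =
      step (lift S X) u zero u-blue′
        (whiteNbrs≤ G (lift S X) u w (λ x a x≢w → blue⇒full (lift S X) x (λ _ → ∨-trueˡ _ (nbrs∈S x a x≢w))))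
        tt (RFoldForcing-mono G ⊆forced forcing₁)
      where
      u-blue′ : lift S X u zero ≡ true
      u-blue′ = [ ∨-trueˡ _ , (λ p → ∨-trueʳ (S u) (∧-true⁺ p refl)) ] u-blue
      ⊆forced : ∀ x j → lift (paint S w) X₁ x j ≡ true → forceAt G (lift S X) u x j ≡ true
      ⊆forced x j p with ∨-true⁻ (paint S w x) p
      ... | inj₂ extra = let x∈X₁ , j≡0 = ∧-true⁻ (X₁ x) extra in
        ∨-trueˡ _ (∨-trueʳ (S x) (∧-true⁺ (X₁⊆X x x∈X₁) j≡0))
      ... | inj₁ x∈S+w with paint⁻ S w x x∈S+w
      ...   | inj₁ x∈S  = ∨-trueˡ _ (∨-trueˡ _ x∈S)
      ...   | inj₂ refl = ∨-trueʳ _ a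

    count-paint : countTrue (paint S w) ≡ suc (countTrue S)
    count-paint = countTrue-paint S w w∉S

    X₁-disjoint′ : ∀ x → X₁ x ≡ true → S x ≡ false
    X₁-disjoint′ x x∈X₁ = ∨-conicalˡ (S x) _ (X₁-disjoint x x∈X₁)

    continue : ∀ b → S u ≡ b → LiftedForcing S
    continue true u∈S = record
      { extra          = X₁
      ; extra-disjoint = X₁-disjoint′
      ; small          = inj₂ small
      ; forcing        = forcing-with X₁ (λ _ p → p) (inj₁ u∈S)
      }
      where
      small : countTrue X₁ + countTrue S < n
      small with small₁
      ... | inj₂ lt  = <-trans (+-monoʳ-< (countTrue X₁) (≤-reflexive (sym count-paint))) lt
      ... | inj₁ all = subst (λ c → c + countTrue S < n) (sym (countTrue-none X₁-empty))
                             (≤-trans (≤-reflexive (sym count-paint)) (countTrue≤ (paint S w)))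
        where
        X₁-empty : ∀ x → X₁ x ≡ false
        X₁-empty x with X₁ x in x∈X₁
        ... | false = refl
        ... | true  = ⊥-elim (true≢false (trans (sym (all x)) (X₁-disjoint x x∈X₁)))
    continue false u∉S = record
      { extra          = paint X₁ u
      ; extra-disjoint = disjoint
      ; small          = inj₂ small
      ; forcing        = forcing-with (paint X₁ u) (paint-⊇ X₁ u) (inj₂ (paint-target X₁ u))
      }
      where
      disjoint : ∀ x → paint X₁ u x ≡ true → S x ≡ false
      disjoint x p with paint⁻ X₁ u x p
      ... | inj₁ x∈X₁ = X₁-disjoint′ x x∈X₁
      ... | inj₂ refl = u∉S
      small : countTrue (paint X₁ u) + countTrue S < n
      small with small₁
      ... | inj₁ all = ⊥-elim ([ (λ u∈S → true≢false (trans (sym u∈S) u∉S)) , adj⇒≢ G a ]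
                                 (paint⁻ S w u (all u)))
      ... | inj₂ lt  = begin-strict
        countTrue (paint X₁ u) + countTrue S   ≤⟨ +-monoˡ-≤ (countTrue S) (countTrue-paint≤ X₁ u) ⟩
        suc (countTrue X₁) + countTrue S       ≡⟨ sym (+-suc (countTrue X₁) (countTrue S)) ⟩
        countTrue X₁ + suc (countTrue S)       ≡⟨ cong (countTrue X₁ +_) (sym count-paint) ⟩
        countTrue X₁ + countTrue (paint S w)   <⟨ lt ⟩
        n                                      ∎
        where open ≤-Reasoning

RProcess-map : ∀ {n r} {G : Graph n} {Ok Ok′ : BColoring n r → Fin n → Set} →
               (∀ {C u} → Ok C u → Ok′ C u) → ∀ {C} → RProcess G r Ok C → RProcess G r Ok′ C
RProcess-map f (done C all)                 = done C all
RProcess-map f (step C u i blue ≤r ok rest) = step C u i blue ≤r (f ok) (RProcess-map f rest)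

module _ {n r : ℕ} (G : Graph n) (u₀ : Fin n) (i₀ : Fin r) where

  record ReplacesCluster (C D : BColoring n r) : Set where
    field
      agree-off  : ∀ x → x ≢ u₀ → ∀ j → D x j ≡ C x j
      keeps-i₀   : D u₀ i₀ ≡ true
      keeps-full : Full C u₀ → Full D u₀

  ReplacesCluster-full : ∀ {C D} → ReplacesCluster C D → ∀ x → Full C x → Full D x
  ReplacesCluster-full {C} {D} rep x full with x ≟ u₀
  ... | yes refl  = ReplacesCluster.keeps-full rep full
  ... | no x≢u₀   = Full-cong C D x (ReplacesCluster.agree-off rep x x≢u₀) full

  -- Every other neighbouring cluster of a forcer is full in C, hence in D, so its white
  -- neighbours in D all lie in the one forced cluster.
  replaceCluster-forcing : ∀ {C D} → RProcess G r (ForcesInto G (λ _ → ⊥)) C → ReplacesCluster C D →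
                           RFoldForcing G r D
  replaceCluster-forcing {D = D} (done C all) rep =
    done D (λ x → full⇒blue D x (ReplacesCluster-full rep x (blue⇒full C x (all x))))
  replaceCluster-forcing {D = D} (step C y i blue _ forces rest) rep =
    step D y (proj₁ forcer) (proj₂ forcer) (whiteNbrs≤ G D y target full-off-target) tt
      (replaceCluster-forcing rest rep′)
    where
    open ReplacesCluster rep
    open ForcesInto forces

    full-off-target : ∀ x → adj G y x ≡ true → x ≢ target → Full D x
    full-off-target x a x≢t with whiteIn C x ≟ℕ 0
    ... | yes full = ReplacesCluster-full rep x full
    ... | no ¬full = [ (λ x≡t → ⊥-elim (x≢t x≡t)) , ⊥-elim ] (others x a ¬full)

    forcer : Σ (Fin r) λ i′ → D y i′ ≡ true
    forcer with y ≟ u₀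
    ... | yes refl  = i₀ , keeps-i₀
    ... | no y≢u₀   = i , trans (agree-off y y≢u₀ i) blue

    stays-full : Full C u₀ → Full (forceAt G D y) u₀
    stays-full fullC = blue⇒full (forceAt G D y) u₀ (λ j → ∨-trueˡ _ (full⇒blue D u₀ (keeps-full fullC) j))

    rep′ : ReplacesCluster (forceAt G C y) (forceAt G D y)
    rep′ = record
      { agree-off  = λ x x≢u₀ j → cong (_∨ adj G y x) (agree-off x x≢u₀ j)
      ; keeps-i₀   = ∨-trueˡ _ keeps-i₀
      ; keeps-full = λ full → [ forceAt-full G D , stays-full ] (forceAt-full⁻ G C y u₀ full)
      }

module _ {n r : ℕ} where

  singletonAt : BColoring n r → Fin n → Fin r → BColoring n r
  singletonAt C u₀ i₀ x j = if does (x ≟ u₀) then does (j ≟ i₀) else C x j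

  singletonAt-off : ∀ C {u₀ i₀} x → x ≢ u₀ → ∀ j → singletonAt C u₀ i₀ x j ≡ C x j
  singletonAt-off C {u₀} {i₀} x x≢u₀ j =
    cong (λ b → if b then does (j ≟ i₀) else C x j) (dec-false (x ≟ u₀) x≢u₀)

  singletonAt-at : ∀ C u₀ i₀ j → singletonAt C u₀ i₀ u₀ j ≡ does (j ≟ i₀)
  singletonAt-at C u₀ i₀ j = cong (λ b → if b then does (j ≟ i₀) else C u₀ j) (dec-true (u₀ ≟ u₀) refl)

  blueIn-singletonAt : ∀ C u₀ i₀ → blueIn (singletonAt C u₀ i₀) u₀ ≡ 1
  blueIn-singletonAt C u₀ i₀ = trans (countTrue-cong (singletonAt-at C u₀ i₀)) (countTrue-singleton i₀)

  card-singletonAt : ∀ C u₀ i₀ → 1 < blueIn C u₀ → card (singletonAt C u₀ i₀) < card C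
  card-singletonAt C u₀ i₀ 1<v =
    sumFin-strict _ _ pointwise u₀ (subst (_< blueIn C u₀) (sym (blueIn-singletonAt C u₀ i₀)) 1<v)
    where
    pointwise : ∀ x → blueIn (singletonAt C u₀ i₀) x ≤ blueIn C x
    pointwise x with x ≟ u₀
    ... | yes refl  = ≤-trans (≤-reflexive (countTrue-singleton i₀)) (<⇒≤ 1<v)
    ... | no _      = ≤-refl

module _ {n r : ℕ} (G : Graph n) where

  minimal⇒partialCluster≤1 : ∀ {B : BColoring n r} → (∀ B′ → RFoldForcing G r B′ → card B ≤ card B′) →
                             RProcess G r (ForcesInto G (λ _ → ⊥)) B → ∀ u₀ → ¬ Full B u₀ → blueIn B u₀ ≤ 1
  minimal⇒partialCluster≤1 {B} minimal process u₀ ¬full with blueIn B u₀ ≤? 1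
  ... | yes v≤1 = v≤1
  ... | no  v≰1 with countTrue≢0⇒some (B u₀) (λ v≡0 → v≰1 (subst (_≤ 1) (sym v≡0) z≤n))
  -- any i₀ will do: the replacing cluster {i₀} need not lie inside B u₀
  ...   | i₀ , _ = contradiction (minimal _ (replaceCluster-forcing G u₀ i₀ process replacement))
                                       (<⇒≱ (card-singletonAt B u₀ i₀ (≰⇒> v≰1)))
    where
    replacement : ReplacesCluster G u₀ i₀ B (singletonAt B u₀ i₀)
    replacement = record
      { agree-off  = singletonAt-off B
      ; keeps-i₀   = trans (singletonAt-at B u₀ i₀ i₀) (dec-true (i₀ ≟ i₀) refl)
      ; keeps-full = λ full → contradiction full ¬full
      }

-- Read with r = q + 1, s = |S| and x = |extra|: the hypothesis is r a + (r − 1) m + ℓ ≤ |B| ≤ r s + x.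
excess⇒a+l≡0 : ∀ q a m l s x → s + x ≤ q → suc q * a + (q * m + l) ≤ suc q * s + x → s < a + m →
               a + l ≡ 0
excess⇒a+l≡0 q a m l s x s+x≤q weights s<a+m = n≤0⇒n≡0 (+-cancelˡ-≤ (q * suc s) (a + l) 0 (begin
  q * suc s + (a + l)       ≤⟨ +-monoˡ-≤ (a + l) (*-monoʳ-≤ q s<a+m) ⟩
  q * (a + m) + (a + l)     ≡⟨ solve 4 (λ q a m l → q :* (a :+ m) :+ (a :+ l) :=
                                                  (con 1 :+ q) :* a :+ (q :* m :+ l)) refl q a m l ⟩
  suc q * a + (q * m + l)   ≤⟨ weights ⟩
  suc q * s + x             ≡⟨ solve 3 (λ q s x → (con 1 :+ q) :* s :+ x := q :* s :+ (s :+ x))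
                                      refl q s x ⟩
  q * s + (s + x)           ≤⟨ +-monoʳ-≤ (q * s) s+x≤q ⟩
  q * s + q                 ≡⟨ solve 2 (λ q s → q :* s :+ q := q :* (con 1 :+ s) :+ con 0) refl q s ⟩
  q * suc s + 0             ∎))
  where open ≤-Reasoning
        open +-*-Solver

module _ {n r : ℕ} (G : Graph n) (B : BColoring n r)
         (minimal : ∀ B′ → RFoldForcing G r B′ → card B ≤ card B′)
         (optimal : RProcess G r (OptimalStep G B) B) where

  noOne⇒noMost : countTrue (isOne B) ≡ 0 → mB B ≡ 0
  noOne⇒noMost noOnes with mB B ≟ℕ 0
  ... | yes m≡0 = m≡0
  ... | no  m≢0 with countTrue≢0⇒some (isMost B) m≢0
  ...   | u₀ , u₀-most with isMost⁻ B u₀-most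
  ...     | 3≤r , v≡r∸1 = contradiction
    (minimal⇒partialCluster≤1 G minimal (RProcess-map (optimalStep⇒forcesInto G B noOne) optimal) u₀ ¬full)
    (<⇒≱ (subst (2 ≤_) (sym v≡r∸1) (∸-monoˡ-≤ 1 3≤r)))
    where
    noOne : ∀ w → blueIn B w ≢ 1
    noOne w one = true≢false (trans (sym (isOne⁺ B 3≤r one)) (countTrue≡0⇒none (isOne B) noOnes w))
    ¬full : ¬ Full B u₀
    ¬full full = r≢r∸1 (≤-trans (s≤s z≤n) 3≤r) (trans (sym (countTrue-all (full⇒blue B u₀ full))) v≡r∸1)

a+m≤skewForcing : ∀ {n r} (G : Graph n) (B : BColoring n r) → n ≤ r →
                  (∀ B′ → RFoldForcing G r B′ → card B ≤ card B′) → RProcess G r (OptimalStep G B) B →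
                  ∀ {S} → SkewForcing G S → aB B + mB B ≤ countTrue S
a+m≤skewForcing {r = zero} G B n≤0 _ _ _ = ≤-trans (≤-trans (a+m≤n B) n≤0) z≤n
a+m≤skewForcing {n} {suc q} G B n≤r minimal optimal {S} skew with liftedForcing G {q} skew
... | record { small = inj₁ all } = subst (aB B + mB B ≤_) (sym (countTrue-all all)) (a+m≤n B)
... | record { extra = X ; small = inj₂ small ; forcing = forcing } with aB B + mB B ≤? countTrue S
...   | yes a+m≤s = a+m≤s
...   | no  a+m≰s = ≤-trans (≤-reflexive (cong₂ _+_ a≡0 m≡0)) z≤n
  where
  s+x≤q : countTrue S + countTrue X ≤ q
  s+x≤q = ≤-pred (≤-trans (subst (_< n) (+-comm (countTrue X) (countTrue S)) small) n≤r)
  weights : suc q * aB B + (q * mB B + countTrue (isOne B)) ≤ suc q * countTrue S + countTrue X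
  weights = ≤-trans (card-lowerBound B) (≤-trans (minimal _ forcing) (card-lift G {q} S X))
  a+l≡0 : aB B + countTrue (isOne B) ≡ 0
  a+l≡0 = excess⇒a+l≡0 q (aB B) (mB B) (countTrue (isOne B)) (countTrue S) (countTrue X)
                        s+x≤q weights (≰⇒> a+m≰s)
  a≡0 : aB B ≡ 0
  a≡0 = m+n≡0⇒m≡0 (aB B) a+l≡0
  m≡0 : mB B ≡ 0
  m≡0 = noOne⇒noMost G B minimal optimal (m+n≡0⇒n≡0 (aB B) a+l≡0)

proposition3p15 : ∀ (n : ℕ) (G : Graph n) (r : ℕ) (B : BColoring n r) →
    n ≤ r → IsOptimalAMON G r B → IsZminus G (aB B + mB B)
proposition3p15 n G r B n≤r (_ , (_ , minimal) , optimal) =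
  (allOrMost B , allOrMost-skewForcing G B n≤r optimal , countTrue-allOrMost B) ,
  (λ S skew → a+m≤skewForcing G B n≤r minimal optimal skew)
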